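{- Fix $\varepsilon\in(0,1)$. There exists a constant $c_\ell>0$ depending only on $\varepsilon$ such that the following holds for all sufficiently large positive integers $k>r$. Let $N=\frac{k}{2r}$ and let $S\subset\mathbb{Z}^3$ be a set of indivisible vectors, each of whose coordinates is an integer between $\lceil\varepsilon N\rceil$ and $N$, such that any three distinct elements of $S$ are linearly independent over $\mathbb{R}$. Let $\mathcal{L}$ be the set of lines $\ell\subset\mathbb{R}^3$ that are parallel to some $\mathbf{v}\in S$ and satisfy $|\ell\cap[k]^3|\ge r$. Then $|\mathcal{L}|\geq c_\ell\cdot\frac{k^3|S|}{r}$.
   Context: $[k]=\{1,\dots,k\}$, so $[k]^3$ is the set of integer points with all coordinates in $\{1,\dots,k\}$. A vector in $\mathbb{Z}^3$ is indivisible if the greatest common divisor of its coordinates is $1$.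
   Formalization: The fixed ε ranges over the rationals in (0,1), and both linear independence of elements of S and the parametrisation of points on the lines ℓ are taken over ℚ instead of ℝ. -}

module Defs where

open import Data.Nat as ℕ using (ℕ)
open import Data.Integer as ℤ using (ℤ; +_)
open import Data.Integer.GCD using (gcd)
open import Data.Nat.Properties using (m*n≢0)
open import Data.Rational as ℚ using (ℚ; _/_)
open import Data.Product using (Σ; ∃; _×_; _,_)
open import Data.Fin using (Fin)
open import Data.List using (List; length)
open import Data.List.Membership.Propositional using (_∈_)
open import Data.List.Relation.Unary.Unique.Propositional using (Unique)
open import Function.Definitions using (Injective)
open import Relation.Nullary using (¬_)
open import Relation.Binary.PropositionalEquality using (_≡_; _≢_)

ℤ³ : Set
ℤ³ = ℤ × ℤ × ℤ

ι : ℤ → ℚ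
ι z = z / 1

ℚ³ : Set
ℚ³ = ℚ × ℚ × ℚ

toℚ³ : ℤ³ → ℚ³
toℚ³ (a , b , c) = ι a , ι b , ι c

_+ᵥ_ : ℚ³ → ℚ³ → ℚ³
(a , b , c) +ᵥ (a' , b' , c') = (a ℚ.+ a') , (b ℚ.+ b') , (c ℚ.+ c')

_·ᵥ_ : ℚ → ℚ³ → ℚ³
t ·ᵥ (a , b , c) = (t ℚ.* a) , (t ℚ.* b) , (t ℚ.* c)

0ᵥ : ℚ³
0ᵥ = ℚ.0ℚ , ℚ.0ℚ , ℚ.0ℚ

Indivisible : ℤ³ → Set
Indivisible (a , b , c) = gcd (gcd a b) c ≡ + 1

LinIndep3 : ℤ³ → ℤ³ → ℤ³ → Set
LinIndep3 u v w = ∀ (a b c : ℚ) →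
  ((a ·ᵥ toℚ³ u) +ᵥ ((b ·ᵥ toℚ³ v) +ᵥ (c ·ᵥ toℚ³ w))) ≡ 0ᵥ →
  (a ≡ ℚ.0ℚ) × (b ≡ ℚ.0ℚ) × (c ≡ ℚ.0ℚ)

InRange : ℕ → ℤ → Set
InRange k x = (+ 1 ℤ.≤ x) × (x ℤ.≤ + k)

InCube : ℕ → ℤ³ → Set
InCube k (a , b , c) = InRange k a × InRange k b × InRange k c

-- a line ℓ = { p + t v : t ∈ ℝ } given by an integer base point p and
-- an integer direction v (nonzero); represented as the pair (p , v)
Line : Set
Line = ℤ³ × ℤ³

OnLine : ℤ³ → Line → Set
OnLine q (p , v) = ∃ λ (t : ℚ) → toℚ³ q ≡ (toℚ³ p +ᵥ (t ·ᵥ toℚ³ v))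

-- two (nonzero-direction) lines are the same subset of space iff
-- their directions are parallel and one base point lies on the other line
SameLine : Line → Line → Set
SameLine (p , v) (p' , v') =
  OnLine p' (p , v) × (∃ λ (s : ℚ) → toℚ³ v' ≡ (s ·ᵥ toℚ³ v))

AtLeastInCube : ℕ → ℕ → Line → Set
AtLeastInCube k r ℓ =
  Σ (Fin r → ℤ³) λ f → Injective _≡_ _≡_ f × (∀ i → InCube k (f i) × OnLine (f i) ℓ)

InL : List ℤ³ → ℕ → ℕ → Line → Set
InL S k r (p , v) = (v ∈ S) × AtLeastInCube k r (p , v)

CardLAtLeast : List ℤ³ → ℕ → ℕ → ℕ → Set
CardLAtLeast S k r m =
  Σ (Fin m → Line) λ g →
    (∀ i j → SameLine (g i) (g j) → i ≡ j) × (∀ i → InL S k r (g i))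

ValidS : ℚ → ℕ → (r : ℕ) → .{{ℕ.NonZero r}} → List ℤ³ → Set
ValidS ε k r S =
  Unique S ×
  (∀ {v} → v ∈ S → Indivisible v) ×
  (∀ {a b c} → (a , b , c) ∈ S →
     CoordOK a × CoordOK b × CoordOK c) ×
  (∀ {u v w} → u ∈ S → v ∈ S → w ∈ S → u ≢ v → v ≢ w → u ≢ w → LinIndep3 u v w)
  where
  N : ℚ
  N = _/_ (+ k) (2 ℕ.* r) {{m*n≢0 2 r}}
  CoordOK : ℤ → Set
  CoordOK x = (ℚ.ceiling (ε ℚ.* N) ℤ.≤ x) × (ι x ℚ.≤ N)

module Submission where

-- Write ε = (e+1)/(d+1), N = k/(2r) and M = ⌈εN⌉. Every v = (A,B,C) ∈ S has coordinates in
-- [M, N], so from any base point p ∈ [1, M] × [1, ⌊k/2⌋]² the r points p, p + v, …, p + (r−1)v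
-- stay in [k]³. The |S|·M·⌊k/2⌋² lines obtained this way are distinct: two positive indivisible
-- parallel vectors are equal, and if two lattice points lie on a line of indivisible direction
-- (A,B,C), then A divides the difference of their first coordinates, which is less than M ≤ A.
-- Since M ≥ k/(2r(d+1)) and ⌊k/2⌋ ≥ k/4, there are at least k³|S| / (32(d+1)r) lines.

open import Defs
open import Data.Fin as Fin using (Fin; toℕ)
import Data.Fin.Properties as FinP
open import Data.Integer as ℤ using (ℤ; +_; -[1+_]; +≤+)
import Data.Integer.DivMod as ℤD
import Data.Integer.Properties as ℤP
open import Data.List using (List; _∷_; length; lookup)
open import Data.List.Membership.Propositional using (_∈_)
open import Data.List.Membership.Propositional.Properties using (∈-lookup)
import Data.List.Relation.Unary.All as All
open import Data.List.Relation.Unary.AllPairs using (_∷_)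
open import Data.List.Relation.Unary.Unique.Propositional using (Unique)
open import Data.Nat as ℕ using (ℕ; zero; suc; _≤_; _<_; z≤n; s≤s; _^_)
open import Data.Nat.Coprimality using (Coprime)
open import Data.Nat.DivMod using (m/n*n≤m; m≡m%n+[m/n]*n; m%n<n; m≥n⇒m/n>0)
open import Data.Nat.Divisibility using (_∣_; divides; ∣-antisym; n∣m*n; >⇒∤)
open import Data.Nat.GCD using (gcd; gcd-greatest; c*gcd[m,n]≡gcd[cm,cn])
import Data.Nat.Properties as ℕP
open import Data.Product using (Σ; ∃; _×_; _,_; proj₁; proj₂)
open import Data.Product.Function.NonDependent.Propositional using (_×-↔_)
open import Data.Rational as ℚ using (ℚ; mkℚ; toℚᵘ; _/_; 0ℚ; 1ℚ)
import Data.Rational.Properties as ℚP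
open import Data.Rational.Unnormalised as ℚᵘ using (mkℚᵘ; *≡*; *≤*)
import Data.Rational.Unnormalised.Properties as ℚᵘP
open import Algebra.Properties.AbelianGroup ℤP.+-0-abelianGroup using () renaming (∙-cancelˡ to +-cancelˡ)
open import Function using (_∘_)
open import Function.Bundles using (_↔_; Inverse; Injection)
open import Function.Properties.Inverse using (↔-refl; ↔-trans; ↔⇒↣)
open import Relation.Binary.PropositionalEquality
open import Relation.Nullary using (contradiction)

ι-toℚᵘ : ∀ z → toℚᵘ (ι z) ℚᵘ.≃ mkℚᵘ z 0
ι-toℚᵘ z = ℚP.toℚᵘ-fromℚᵘ (mkℚᵘ z 0)

ι-injective : ∀ {x y} → ι x ≡ ι y → x ≡ y
ι-injective {x} {y} eq
  with ℚᵘP.≃-trans (ℚᵘP.≃-sym (ι-toℚᵘ x)) (ℚᵘP.≃-trans (ℚP.toℚᵘ-cong eq) (ι-toℚᵘ y))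
... | *≡* e = trans (sym (ℤP.*-identityʳ x)) (trans e (ℤP.*-identityʳ y))

ι-homo-+ : ∀ x y → ι (x ℤ.+ y) ≡ ι x ℚ.+ ι y
ι-homo-+ x y = ℚP.toℚᵘ-injective (begin
  toℚᵘ (ι (x ℤ.+ y))                 ≈⟨ ι-toℚᵘ (x ℤ.+ y) ⟩
  mkℚᵘ (x ℤ.+ y) 0                   ≈⟨ *≡* (cong (ℤ._* + 1) (cong₂ ℤ._+_ (x≡x*1 x) (x≡x*1 y))) ⟩
  mkℚᵘ x 0 ℚᵘ.+ mkℚᵘ y 0             ≈⟨ ℚᵘP.+-cong (ι-toℚᵘ⁻¹ x) (ι-toℚᵘ⁻¹ y) ⟩
  toℚᵘ (ι x) ℚᵘ.+ toℚᵘ (ι y)         ≈⟨ ℚᵘP.≃-sym (ℚP.toℚᵘ-homo-+ (ι x) (ι y)) ⟩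
  toℚᵘ (ι x ℚ.+ ι y)                 ∎)
  where
  open ℚᵘP.≃-Reasoning
  x≡x*1 : ∀ x → x ≡ x ℤ.* + 1
  x≡x*1 x = sym (ℤP.*-identityʳ x)
  ι-toℚᵘ⁻¹ : ∀ z → mkℚᵘ z 0 ℚᵘ.≃ toℚᵘ (ι z)
  ι-toℚᵘ⁻¹ z = ℚᵘP.≃-sym (ι-toℚᵘ z)

ι-homo-* : ∀ x y → ι (x ℤ.* y) ≡ ι x ℚ.* ι y
ι-homo-* x y = ℚP.toℚᵘ-injective (begin
  toℚᵘ (ι (x ℤ.* y))                 ≈⟨ ι-toℚᵘ (x ℤ.* y) ⟩
  mkℚᵘ x 0 ℚᵘ.* mkℚᵘ y 0             ≈⟨ ℚᵘP.≃-sym (ℚᵘP.*-cong (ι-toℚᵘ x) (ι-toℚᵘ y)) ⟩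
  toℚᵘ (ι x) ℚᵘ.* toℚᵘ (ι y)         ≈⟨ ℚᵘP.≃-sym (ℚP.toℚᵘ-homo-* (ι x) (ι y)) ⟩
  toℚᵘ (ι x ℚ.* ι y)                 ∎)
  where open ℚᵘP.≃-Reasoning

toℚᵘ-/ : ∀ z n → toℚᵘ (z / suc n) ℚᵘ.≃ mkℚᵘ z n
toℚᵘ-/ z n = ℚP.toℚᵘ-fromℚᵘ (mkℚᵘ z n)

≤-toℚᵘ : ∀ {p q P Q} → toℚᵘ p ℚᵘ.≃ P → toℚᵘ q ℚᵘ.≃ Q → p ℚ.≤ q → P ℚᵘ.≤ Q
≤-toℚᵘ p≃P q≃Q p≤q = ℚᵘP.≤-respʳ-≃ q≃Q (ℚᵘP.≤-respˡ-≃ p≃P (ℚP.toℚᵘ-mono-≤ p≤q))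

≤-fromℚᵘ : ∀ {p q P Q} → toℚᵘ p ℚᵘ.≃ P → toℚᵘ q ℚᵘ.≃ Q → P ℚᵘ.≤ Q → p ℚ.≤ q
≤-fromℚᵘ p≃P q≃Q P≤Q =
  ℚP.toℚᵘ-cancel-≤ (ℚᵘP.≤-respʳ-≃ (ℚᵘP.≃-sym q≃Q) (ℚᵘP.≤-respˡ-≃ (ℚᵘP.≃-sym p≃P) P≤Q))

-- The case split on the numerator only lets `ℚ.-` (hence `ℚ.ceiling`) compute.
p≤ι⌈p⌉ : ∀ p → p ℚ.≤ ι (ℚ.ceiling p)
p≤ι⌈p⌉ p = ≤-fromℚᵘ ℚᵘP.≃-refl (ι-toℚᵘ (ℚ.ceiling p)) (*≤* (cross p))
  where
  n≤-[-n/d]*d : ∀ n d → n ℤ.* + 1 ℤ.≤ ℤ.- ((ℤ.- n) ℤ./ + suc d) ℤ.* + suc d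
  n≤-[-n/d]*d n d = subst₂ ℤ._≤_ (trans (ℤP.neg-involutive n) (sym (ℤP.*-identityʳ n)))
    (ℤP.neg-distribˡ-* ((ℤ.- n) ℤ./ + suc d) (+ suc d)) (ℤP.neg-mono-≤ (ℤD.[n/d]*d≤n (ℤ.- n) (+ suc d)))
  cross : ∀ p → ℚᵘ.↥ (toℚᵘ p) ℤ.* + 1 ℤ.≤ ℚ.ceiling p ℤ.* ℚᵘ.↧ (toℚᵘ p)
  cross (mkℚ -[1+ n ] d _)  = n≤-[-n/d]*d -[1+ n ] d
  cross (mkℚ (+ zero) d _)  = n≤-[-n/d]*d (+ zero) d
  cross (mkℚ (+ suc n) d _) = n≤-[-n/d]*d (+ suc n) d

proportional⇒cross : ∀ X Y a b (t : ℚ) → ι X ≡ t ℚ.* ι a → ι Y ≡ t ℚ.* ι b → X ℤ.* b ≡ Y ℤ.* a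
proportional⇒cross X Y a b t X≡ta Y≡tb = ι-injective (begin
  ι (X ℤ.* b)           ≡⟨ ι-homo-* X b ⟩
  ι X ℚ.* ι b           ≡⟨ cong (ℚ._* ι b) X≡ta ⟩
  (t ℚ.* ι a) ℚ.* ι b   ≡⟨ solve 3 (λ t x y → (t :* x) :* y := (t :* y) :* x) refl t (ι a) (ι b) ⟩
  (t ℚ.* ι b) ℚ.* ι a   ≡⟨ cong (ℚ._* ι a) (sym Y≡tb) ⟩
  ι Y ℚ.* ι a           ≡⟨ sym (ι-homo-* Y a) ⟩
  ι (Y ℤ.* a)           ∎)
  where
  open ≡-Reasoning
  open import Data.Rational.Solver
  open +-*-Solver

offset-proportional : ∀ q p a (t : ℚ) → ι q ≡ ι p ℚ.+ t ℚ.* ι a → ι (q ℤ.- p) ≡ t ℚ.* ι a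
offset-proportional q p a t q≡p+ta = begin
  ι (q ℤ.- p)                                  ≡⟨ solve 2 (λ d p → d := (d :+ p) :- p) refl (ι (q ℤ.- p)) (ι p) ⟩
  (ι (q ℤ.- p) ℚ.+ ι p) ℚ.- ι p                ≡⟨ cong (ℚ._- ι p) (sym (ι-homo-+ (q ℤ.- p) p)) ⟩
  ι (q ℤ.- p ℤ.+ p) ℚ.- ι p                    ≡⟨ cong (λ z → ι z ℚ.- ι p) q-p+p≡q ⟩
  ι q ℚ.- ι p                                  ≡⟨ cong (ℚ._- ι p) q≡p+ta ⟩
  (ι p ℚ.+ t ℚ.* ι a) ℚ.- ι p                  ≡⟨ solve 3 (λ p t a → p :+ t :* a :- p := t :* a) refl (ι p) t (ι a) ⟩
  t ℚ.* ι a                                    ∎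
  where
  q-p+p≡q : q ℤ.- p ℤ.+ p ≡ q
  q-p+p≡q = trans (ℤP.+-assoc q (ℤ.- p) p) (trans (cong (λ z → q ℤ.+ z) (ℤP.+-inverseˡ p)) (ℤP.+-identityʳ q))
  open ≡-Reasoning
  open import Data.Rational.Solver
  open +-*-Solver

∣-cancel-gcd³ : ∀ {A B C D} → gcd (gcd A B) C ≡ 1 → A ∣ D ℕ.* B → A ∣ D ℕ.* C → A ∣ D
∣-cancel-gcd³ {A} {B} {C} {D} gcd≡1 A∣DB A∣DC =
  subst (A ∣_) gcd[DA,DB,DC]≡D (gcd-greatest (gcd-greatest (n∣m*n D) A∣DB) A∣DC)
  where
  gcd[DA,DB,DC]≡D : gcd (gcd (D ℕ.* A) (D ℕ.* B)) (D ℕ.* C) ≡ D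
  gcd[DA,DB,DC]≡D = begin
    gcd (gcd (D ℕ.* A) (D ℕ.* B)) (D ℕ.* C) ≡⟨ cong (λ g → gcd g (D ℕ.* C)) (sym (c*gcd[m,n]≡gcd[cm,cn] D A B)) ⟩
    gcd (D ℕ.* gcd A B) (D ℕ.* C)           ≡⟨ sym (c*gcd[m,n]≡gcd[cm,cn] D (gcd A B) C) ⟩
    D ℕ.* gcd (gcd A B) C                   ≡⟨ cong (D ℕ.*_) gcd≡1 ⟩
    D ℕ.* 1                                 ≡⟨ ℕP.*-identityʳ D ⟩
    D                                       ∎
    where open ≡-Reasoning

proportional-indivisible⇒≡ : ∀ {A B C A′ B′ C′} .{{_ : ℕ.NonZero A}} →
  gcd (gcd A B) C ≡ 1 → gcd (gcd A′ B′) C′ ≡ 1 →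
  A′ ℕ.* B ≡ B′ ℕ.* A → A′ ℕ.* C ≡ C′ ℕ.* A →
  A ≡ A′ × B ≡ B′ × C ≡ C′
proportional-indivisible⇒≡ {A} {B} {C} {A′} {B′} {C′} gcd≡1 gcd′≡1 A′B≡B′A A′C≡C′A =
  A≡A′ , cancel B B′ A′B≡B′A , cancel C C′ A′C≡C′A
  where
  A≡A′ : A ≡ A′
  A≡A′ = ∣-antisym
    (∣-cancel-gcd³ gcd≡1 (divides B′ A′B≡B′A) (divides C′ A′C≡C′A))
    (∣-cancel-gcd³ gcd′≡1 (divides B (trans (ℕP.*-comm A B′) (trans (sym A′B≡B′A) (ℕP.*-comm A′ B))))
                          (divides C (trans (ℕP.*-comm A C′) (trans (sym A′C≡C′A) (ℕP.*-comm A′ C)))))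
  cancel : ∀ X X′ → A′ ℕ.* X ≡ X′ ℕ.* A → X ≡ X′
  cancel X X′ A′X≡X′A = ℕP.*-cancelˡ-≡ X X′ A
    (trans (cong (ℕ._* X) A≡A′) (trans A′X≡X′A (ℕP.*-comm X′ A)))

cross⇒∣ : ∀ {A B} X Y → X ℤ.* + B ≡ Y ℤ.* + A → A ∣ ℤ.∣ X ∣ ℕ.* B
cross⇒∣ {A} {B} X Y XB≡YA =
  divides ℤ.∣ Y ∣ (trans (sym (ℤP.abs-* X (+ B))) (trans (cong ℤ.∣_∣ XB≡YA) (ℤP.abs-* Y (+ A))))

∣<⇒≡0 : ∀ {A D} → A ∣ D → D < A → D ≡ 0
∣<⇒≡0 {D = zero}  _   _   = refl
∣<⇒≡0 {D = suc _} A∣D D<A = contradiction A∣D (>⇒∤ D<A)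

indivisible-offset≡0 : ∀ {A B C} dx dy dz → gcd (gcd A B) C ≡ 1 →
  dx ℤ.* + B ≡ dy ℤ.* + A → dx ℤ.* + C ≡ dz ℤ.* + A → ℤ.∣ dx ∣ < A →
  dx ≡ + 0 × dy ≡ + 0 × dz ≡ + 0
indivisible-offset≡0 {A} {B} {C} dx dy dz gcd≡1 dxB≡dyA dxC≡dzA ∣dx∣<A =
  dx≡0 , from-dx≡0 dy dxB≡dyA , from-dx≡0 dz dxC≡dzA
  where
  instance
    A≢0 : ℕ.NonZero A
    A≢0 = ℕ.>-nonZero (ℕP.≤-<-trans ℕ.z≤n ∣dx∣<A)
  dx≡0 : dx ≡ + 0
  dx≡0 = ℤP.∣i∣≡0⇒i≡0 (∣<⇒≡0 A∣∣dx∣ ∣dx∣<A)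
    where
    A∣∣dx∣ : A ∣ ℤ.∣ dx ∣
    A∣∣dx∣ = ∣-cancel-gcd³ gcd≡1 (cross⇒∣ dx dy dxB≡dyA) (cross⇒∣ dx dz dxC≡dzA)
  from-dx≡0 : ∀ {E} d → dx ℤ.* + E ≡ d ℤ.* + A → d ≡ + 0
  from-dx≡0 {E} d dxE≡dA = ℤP.*-cancelʳ-≡ d (+ 0) (+ A)
    (trans (sym dxE≡dA) (cong (ℤ._* + E) dx≡0))

record Admissible (k r M : ℕ) (v : ℤ³) : Set where
  constructor admissible
  field
    A B C       : ℕ
    v≡          : v ≡ (+ A , + B , + C)
    M≤A         : M ≤ A
    A*2r≤k      : A ℕ.* (2 ℕ.* r) ≤ k
    B*2r≤k      : B ℕ.* (2 ℕ.* r) ≤ k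
    C*2r≤k      : C ℕ.* (2 ℕ.* r) ≤ k
    indivisible : gcd (gcd A B) C ≡ 1

basePoint : ℕ → ℕ → ℕ → ℤ³
basePoint x y z = + suc x , + suc y , + suc z

step : ℤ → ℕ → ℤ → ℤ
step p t a = p ℤ.+ + t ℤ.* a

ι-step : ∀ p t a → ι (step p t a) ≡ ι p ℚ.+ ι (+ t) ℚ.* ι a
ι-step p t a = trans (ι-homo-+ p (+ t ℤ.* a)) (cong (ι p ℚ.+_) (ι-homo-* (+ t) a))

+≤⇐2*≤ : ∀ {a b k} → 2 ℕ.* a ≤ k → 2 ℕ.* b ≤ k → a ℕ.+ b ≤ k
+≤⇐2*≤ {a} {b} {k} 2a≤k 2b≤k = ℕP.*-cancelˡ-≤ 2 (ℕP.≤-trans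
  (ℕP.≤-reflexive (ℕP.*-distribˡ-+ 2 a b)) (ℕP.≤-trans (ℕP.+-mono-≤ 2a≤k 2b≤k)
  (ℕP.≤-reflexive (cong (k ℕ.+_) (sym (ℕP.+-identityʳ k))))))

step-inRange : ∀ {k r β t V} → 1 ≤ β → 2 ℕ.* β ≤ k → t < r → V ℕ.* (2 ℕ.* r) ≤ k →
  InRange k (step (+ β) t (+ V))
step-inRange {k} {r} {β} {t} {V} 1≤β 2β≤k t<r V*2r≤k =
  subst (InRange k) (cong (λ u → + β ℤ.+ u) (ℤP.pos-* t V))
    (+≤+ (ℕP.≤-trans 1≤β (ℕP.m≤m+n β (t ℕ.* V))) , +≤+ (+≤⇐2*≤ {β} {t ℕ.* V} 2β≤k 2tV≤k))
  where
  2tV≤k : 2 ℕ.* (t ℕ.* V) ≤ k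
  2tV≤k = begin
    2 ℕ.* (t ℕ.* V)   ≤⟨ ℕP.*-monoʳ-≤ 2 (ℕP.*-monoˡ-≤ V (ℕP.<⇒≤ t<r)) ⟩
    2 ℕ.* (r ℕ.* V)   ≡⟨ solve 2 (λ r V → con 2 :* (r :* V) := V :* (con 2 :* r)) refl r V ⟩
    V ℕ.* (2 ℕ.* r)   ≤⟨ V*2r≤k ⟩
    k                 ∎
    where
    open ℕP.≤-Reasoning
    open import Data.Nat.Solver
    open +-*-Solver

ℤ-cross⇒ℕ-cross : ∀ a b c d → + a ℤ.* + b ≡ + c ℤ.* + d → a ℕ.* b ≡ c ℕ.* d
ℤ-cross⇒ℕ-cross a b c d eq = ℤP.+-injective (trans (ℤP.pos-* a b) (trans eq (sym (ℤP.pos-* c d))))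

_-³_ : ℤ³ → ℤ³ → ℤ³
(a , b , c) -³ (a′ , b′ , c′) = a ℤ.- a′ , b ℤ.- b′ , c ℤ.- c′

Parallel : ℤ³ → ℤ³ → Set
Parallel u v = ∃ λ (s : ℚ) → toℚ³ u ≡ s ·ᵥ toℚ³ v

onLine⇒parallel : ∀ q p v → OnLine q (p , v) → Parallel (q -³ p) v
onLine⇒parallel (q₁ , q₂ , q₃) (p₁ , p₂ , p₃) (a , b , c) (t , q≡p+tv) =
  t , cong₂ _,_ (offset-proportional q₁ p₁ a t (cong proj₁ q≡p+tv))
        (cong₂ _,_ (offset-proportional q₂ p₂ b t (cong (proj₁ ∘ proj₂) q≡p+tv))
                   (offset-proportional q₃ p₃ c t (cong (proj₂ ∘ proj₂) q≡p+tv)))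

parallel⇒cross : ∀ X Y Z a b c → Parallel (X , Y , Z) (a , b , c) →
  X ℤ.* b ≡ Y ℤ.* a × X ℤ.* c ≡ Z ℤ.* a
parallel⇒cross X Y Z a b c (s , u≡sv) =
  proportional⇒cross X Y a b s (cong proj₁ u≡sv) (cong (proj₁ ∘ proj₂) u≡sv) ,
  proportional⇒cross X Z a c s (cong proj₁ u≡sv) (cong (proj₂ ∘ proj₂) u≡sv)

parallel-indivisible⇒≡ : ∀ {A B C A′ B′ C′} .{{_ : ℕ.NonZero A}} →
  gcd (gcd A B) C ≡ 1 → gcd (gcd A′ B′) C′ ≡ 1 →
  Parallel (+ A′ , + B′ , + C′) (+ A , + B , + C) →
  (+ A , + B , + C) ≡ (+ A′ , + B′ , + C′)
parallel-indivisible⇒≡ {A} {B} {C} {A′} {B′} {C′} gcd≡1 gcd′≡1 v′∥v =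
  cong₂ _,_ (cong +_ A≡A′) (cong₂ _,_ (cong +_ B≡B′) (cong +_ C≡C′))
  where
  cross : + A′ ℤ.* + B ≡ + B′ ℤ.* + A × + A′ ℤ.* + C ≡ + C′ ℤ.* + A
  cross = parallel⇒cross (+ A′) (+ B′) (+ C′) (+ A) (+ B) (+ C) v′∥v
  equal : A ≡ A′ × B ≡ B′ × C ≡ C′
  equal = proportional-indivisible⇒≡ gcd≡1 gcd′≡1
            (ℤ-cross⇒ℕ-cross A′ B B′ A (proj₁ cross)) (ℤ-cross⇒ℕ-cross A′ C C′ A (proj₂ cross))
  A≡A′ : A ≡ A′
  A≡A′ = proj₁ equal
  B≡B′ : B ≡ B′
  B≡B′ = proj₁ (proj₂ equal)
  C≡C′ : C ≡ C′
  C≡C′ = proj₂ (proj₂ equal)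

∣[1+x′]-[1+x]∣< : ∀ {x x′ A} → x < A → x′ < A → ℤ.∣ + suc x′ ℤ.- + suc x ∣ < A
∣[1+x′]-[1+x]∣< {x} {x′} x<A x′<A = begin-strict
  ℤ.∣ + suc x′ ℤ.- + suc x ∣ ≡⟨ cong ℤ.∣_∣ (ℤP.[+m]-[+n]≡m⊖n (suc x′) (suc x)) ⟩
  ℤ.∣ suc x′ ℤ.⊖ suc x ∣     ≡⟨ cong ℤ.∣_∣ (ℤP.[1+m]⊖[1+n]≡m⊖n x′ x) ⟩
  ℤ.∣ x′ ℤ.⊖ x ∣             ≤⟨ ℤP.∣m⊝n∣≤m⊔n x′ x ⟩
  x′ ℕ.⊔ x                   <⟨ ℕP.⊔-lub x′<A x<A ⟩
  _                          ∎
  where open ℕP.≤-Reasoning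

[1+x′]-[1+x]≡0⇒x≡x′ : ∀ {x x′} → + suc x′ ℤ.- + suc x ≡ + 0 → x ≡ x′
[1+x′]-[1+x]≡0⇒x≡x′ {x} {x′} eq = sym (ℕP.suc-injective (ℤP.+-injective (ℤP.i-j≡0⇒i≡j _ _ eq)))

basePoint-unique : ∀ {A B C x y z x′ y′ z′} → gcd (gcd A B) C ≡ 1 → x < A → x′ < A →
  OnLine (basePoint x′ y′ z′) (basePoint x y z , (+ A , + B , + C)) →
  x ≡ x′ × y ≡ y′ × z ≡ z′
basePoint-unique {A} {B} {C} {x} {y} {z} {x′} {y′} {z′} gcd≡1 x<A x′<A p′∈ℓ =
  [1+x′]-[1+x]≡0⇒x≡x′ (proj₁ offset≡0) ,
  [1+x′]-[1+x]≡0⇒x≡x′ (proj₁ (proj₂ offset≡0)) ,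
  [1+x′]-[1+x]≡0⇒x≡x′ (proj₂ (proj₂ offset≡0))
  where
  dx dy dz : ℤ
  dx = + suc x′ ℤ.- + suc x
  dy = + suc y′ ℤ.- + suc y
  dz = + suc z′ ℤ.- + suc z
  cross : dx ℤ.* + B ≡ dy ℤ.* + A × dx ℤ.* + C ≡ dz ℤ.* + A
  cross = parallel⇒cross dx dy dz (+ A) (+ B) (+ C)
    (onLine⇒parallel (basePoint x′ y′ z′) (basePoint x y z) (+ A , + B , + C) p′∈ℓ)
  offset≡0 : dx ≡ + 0 × dy ≡ + 0 × dz ≡ + 0
  offset≡0 = indivisible-offset≡0 dx dy dz gcd≡1 (proj₁ cross) (proj₂ cross) (∣[1+x′]-[1+x]∣< x<A x′<A)

line-meets-cube : ∀ {k r M v x y z} .{{_ : ℕ.NonZero r}} → Admissible k r M v →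
  x < M → 2 ℕ.* suc y ≤ k → 2 ℕ.* suc z ≤ k → AtLeastInCube k r (basePoint x y z , v)
line-meets-cube {k} {r} {M} {x = x} {y} {z} (admissible A B C refl M≤A A*2r≤k B*2r≤k C*2r≤k _) x<M 2y≤k 2z≤k =
  point , point-injective , λ t → inCube t , onLine t
  where
  instance
    A≢0 : ℕ.NonZero A
    A≢0 = ℕ.>-nonZero (ℕP.m<n⇒0<n (ℕP.<-≤-trans x<M M≤A))
  point : Fin r → ℤ³
  point t = step (+ suc x) (toℕ t) (+ A) , step (+ suc y) (toℕ t) (+ B) , step (+ suc z) (toℕ t) (+ C)
  point-injective : ∀ {t t′} → point t ≡ point t′ → t ≡ t′
  point-injective {t} {t′} eq = FinP.toℕ-injective (ℤP.+-injective
    (ℤP.*-cancelʳ-≡ (+ toℕ t) (+ toℕ t′) (+ A) (+-cancelˡ (+ suc x) _ _ (cong proj₁ eq))))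
  2x≤k : 2 ℕ.* suc x ≤ k
  2x≤k = begin
    2 ℕ.* suc x      ≤⟨ ℕP.*-monoʳ-≤ 2 (ℕP.<-≤-trans x<M M≤A) ⟩
    2 ℕ.* A          ≡⟨ ℕP.*-comm 2 A ⟩
    A ℕ.* 2          ≤⟨ ℕP.*-monoʳ-≤ A (ℕP.m≤m*n 2 r) ⟩
    A ℕ.* (2 ℕ.* r)  ≤⟨ A*2r≤k ⟩
    k                ∎
    where open ℕP.≤-Reasoning
  inCube : ∀ t → InCube k (point t)
  inCube t = step-inRange (s≤s z≤n) 2x≤k (FinP.toℕ<n t) A*2r≤k
           , step-inRange (s≤s z≤n) 2y≤k (FinP.toℕ<n t) B*2r≤k
           , step-inRange (s≤s z≤n) 2z≤k (FinP.toℕ<n t) C*2r≤k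
  onLine : ∀ t → OnLine (point t) (basePoint x y z , (+ A , + B , + C))
  onLine t = ι (+ toℕ t) , cong₂ _,_ (ι-step (+ suc x) (toℕ t) (+ A))
                           (cong₂ _,_ (ι-step (+ suc y) (toℕ t) (+ B)) (ι-step (+ suc z) (toℕ t) (+ C)))

sameLine⇒≡ : ∀ {k r M v v′ x y z x′ y′ z′} → Admissible k r M v → Admissible k r M v′ → x < M → x′ < M →
  SameLine (basePoint x y z , v) (basePoint x′ y′ z′ , v′) →
  v ≡ v′ × x ≡ x′ × y ≡ y′ × z ≡ z′
sameLine⇒≡ (admissible A B C refl M≤A _ _ _ gcd≡1) (admissible A′ B′ C′ refl _ _ _ _ gcd′≡1)
  x<M x′<M (p′∈ℓ , v′∥v) =
  parallel-indivisible⇒≡ {{A≢0}} gcd≡1 gcd′≡1 v′∥v ,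
  basePoint-unique gcd≡1 (ℕP.<-≤-trans x<M M≤A) (ℕP.<-≤-trans x′<M M≤A) p′∈ℓ
  where
  A≢0 : ℕ.NonZero A
  A≢0 = ℕ.>-nonZero (ℕP.m<n⇒0<n (ℕP.<-≤-trans x<M M≤A))

lookup-injective : ∀ {A : Set} {xs : List A} → Unique xs → ∀ i j → lookup xs i ≡ lookup xs j → i ≡ j
lookup-injective {xs = _ ∷ _} (_  ∷ _) Fin.zero    Fin.zero    _  = refl
lookup-injective {xs = _ ∷ _} (x∉ ∷ _) Fin.zero    (Fin.suc j) eq = contradiction eq (All.lookup x∉ (∈-lookup j))
lookup-injective {xs = _ ∷ _} (x∉ ∷ _) (Fin.suc i) Fin.zero    eq = contradiction (sym eq) (All.lookup x∉ (∈-lookup i))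
lookup-injective {xs = _ ∷ _} (_ ∷ u)  (Fin.suc i) (Fin.suc j) eq = cong Fin.suc (lookup-injective u i j eq)

Fin-*↔× : ∀ {a b c d} → Fin (a ℕ.* (b ℕ.* (c ℕ.* d))) ↔ (Fin a × Fin b × Fin c × Fin d)
Fin-*↔× {a} {b} {c} {d} =
  ↔-trans (FinP.*↔× {a}) (↔-refl ×-↔ ↔-trans (FinP.*↔× {b}) (↔-refl ×-↔ FinP.*↔× {c}))

half : ℕ → ℕ
half k = k ℕ./ 2

2*[1+i]≤k : ∀ {k} (i : Fin (half k)) → 2 ℕ.* suc (toℕ i) ≤ k
2*[1+i]≤k {k} i = ℕP.≤-trans (ℕP.*-monoʳ-≤ 2 (FinP.toℕ<n i))
  (ℕP.≤-trans (ℕP.≤-reflexive (ℕP.*-comm 2 (half k))) (m/n*n≤m k 2))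

module _ (k r M : ℕ) .{{_ : ℕ.NonZero r}} (S : List ℤ³) where

  LineIndex : ℕ
  LineIndex = length S ℕ.* (M ℕ.* (half k ℕ.* half k))

  lineAt : Fin (length S) × Fin M × Fin (half k) × Fin (half k) → Line
  lineAt (s , x , y , z) = basePoint (toℕ x) (toℕ y) (toℕ z) , lookup S s

  module _ (unique : Unique S) (S-admissible : ∀ {v} → v ∈ S → Admissible k r M v) where

    lineAt-injective : ∀ I J → SameLine (lineAt I) (lineAt J) → I ≡ J
    lineAt-injective (s , x , y , z) (s′ , x′ , y′ , z′) same =
      cong₂ _,_ (lookup-injective unique s s′ v≡v′)
        (cong₂ _,_ (FinP.toℕ-injective x≡x′) (cong₂ _,_ (FinP.toℕ-injective y≡y′) (FinP.toℕ-injective z≡z′)))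
      where
      equal : lookup S s ≡ lookup S s′ × toℕ x ≡ toℕ x′ × toℕ y ≡ toℕ y′ × toℕ z ≡ toℕ z′
      equal = sameLine⇒≡ (S-admissible (∈-lookup s)) (S-admissible (∈-lookup s′)) (FinP.toℕ<n x) (FinP.toℕ<n x′) same
      v≡v′ : lookup S s ≡ lookup S s′
      v≡v′ = proj₁ equal
      x≡x′ : toℕ x ≡ toℕ x′
      x≡x′ = proj₁ (proj₂ equal)
      y≡y′ : toℕ y ≡ toℕ y′
      y≡y′ = proj₁ (proj₂ (proj₂ equal))
      z≡z′ : toℕ z ≡ toℕ z′
      z≡z′ = proj₂ (proj₂ (proj₂ equal))

    many-lines : CardLAtLeast S k r LineIndex
    many-lines = lineAt ∘ index , distinct , λ i → ∈-lookup (proj₁ (index i)) , meets (index i)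
      where
      index : Fin LineIndex → Fin (length S) × Fin M × Fin (half k) × Fin (half k)
      index = Inverse.to Fin-*↔×
      meets : ∀ I → AtLeastInCube k r (lineAt I)
      meets (s , x , y , z) = line-meets-cube (S-admissible (∈-lookup s)) (FinP.toℕ<n x) (2*[1+i]≤k y) (2*[1+i]≤k z)
      distinct : ∀ i j → SameLine (lineAt (index i)) (lineAt (index j)) → i ≡ j
      distinct i j same = Injection.injective (↔⇒↣ Fin-*↔×) (lineAt-injective (index i) (index j) same)

k≤4*half : ∀ {k} → 2 ≤ k → k ≤ 4 ℕ.* half k
k≤4*half {k} 2≤k = begin
  k                             ≡⟨ m≡m%n+[m/n]*n k 2 ⟩
  k ℕ.% 2 ℕ.+ half k ℕ.* 2      ≤⟨ ℕP.+-monoˡ-≤ (half k ℕ.* 2) k%2≤half*2 ⟩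
  half k ℕ.* 2 ℕ.+ half k ℕ.* 2 ≡⟨ solve 1 (λ h → h :* con 2 :+ h :* con 2 := con 4 :* h) refl (half k) ⟩
  4 ℕ.* half k                  ∎
  where
  open ℕP.≤-Reasoning
  open import Data.Nat.Solver
  open +-*-Solver
  k%2≤half*2 : k ℕ.% 2 ≤ half k ℕ.* 2
  k%2≤half*2 = ℕP.≤-trans (ℕP.≤-pred (m%n<n k 2)) (ℕP.≤-trans (m≥n⇒m/n>0 2≤k) (ℕP.m≤m*n (half k) 2))

cube≤ : ∀ L M h {k} D r → k ≤ M ℕ.* (D ℕ.* (2 ℕ.* r)) → k ≤ 4 ℕ.* h →
  k ^ 3 ℕ.* L ≤ L ℕ.* (M ℕ.* (h ℕ.* h)) ℕ.* (32 ℕ.* D ℕ.* r)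
cube≤ L M h {k} D r k≤M*D*2r k≤4h = begin
  k ^ 3 ℕ.* L                            ≡⟨ solve 2 (λ k L → (k :^ 3) :* L := L :* (k :* (k :* k))) refl k L ⟩
  L ℕ.* (k ℕ.* (k ℕ.* k))                 ≤⟨ ℕP.*-monoʳ-≤ L (ℕP.*-mono-≤ k≤M*D*2r (ℕP.*-mono-≤ k≤4h k≤4h)) ⟩
  L ℕ.* (M ℕ.* (D ℕ.* (2 ℕ.* r)) ℕ.* (4 ℕ.* h ℕ.* (4 ℕ.* h)))
                                         ≡⟨ solve 5 (λ L M h D r → L :* (M :* (D :* (con 2 :* r)) :* (con 4 :* h :* (con 4 :* h)))
                                                               := L :* (M :* (h :* h)) :* (con 32 :* D :* r)) refl L M h D r ⟩
  L ℕ.* (M ℕ.* (h ℕ.* h)) ℕ.* (32 ℕ.* D ℕ.* r) ∎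
  where
  open ℕP.≤-Reasoning
  open import Data.Nat.Solver
  open +-*-Solver

[1/a]*[X/b]≤Y : ∀ a b .{{_ : ℕ.NonZero a}} .{{_ : ℕ.NonZero b}} {X Y} → X ≤ Y ℕ.* (a ℕ.* b) →
  (+ 1 ℚ./ a) ℚ.* (+ X ℚ./ b) ℚ.≤ (+ Y ℚ./ 1)
[1/a]*[X/b]≤Y (suc a) (suc b) {X} {Y} X≤Y*ab = ≤-fromℚᵘ lhs≃ (toℚᵘ-/ (+ Y) 0) (*≤* cross)
  where
  lhs≃ : toℚᵘ ((+ 1 ℚ./ suc a) ℚ.* (+ X ℚ./ suc b)) ℚᵘ.≃ mkℚᵘ (+ 1) a ℚᵘ.* mkℚᵘ (+ X) b
  lhs≃ = ℚᵘP.≃-trans (ℚP.toℚᵘ-homo-* (+ 1 ℚ./ suc a) (+ X ℚ./ suc b)) (ℚᵘP.*-cong (toℚᵘ-/ (+ 1) a) (toℚᵘ-/ (+ X) b))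
  cross : (+ 1 ℤ.* + X) ℤ.* + 1 ℤ.≤ + Y ℤ.* + (suc a ℕ.* suc b)
  cross = subst₂ ℤ._≤_ (sym (trans (ℤP.*-identityʳ _) (ℤP.*-identityˡ (+ X)))) (ℤP.pos-* Y _) (+≤+ X≤Y*ab)

module _ (e d : ℕ) .{coprime : Coprime (suc e) (suc d)} (k r′ : ℕ) where

  ε : ℚ
  ε = mkℚ (+ suc e) d coprime

  N : ℚ
  N = + k ℚ./ (2 ℕ.* suc r′)

  ⌈εN⌉ : ℤ
  ⌈εN⌉ = ℚ.ceiling (ε ℚ.* N)

  -- ε ≥ 1/(d+1), so ⌈εN⌉ ≥ k / (2r(d+1)).
  ⌈εN⌉-bound : ∃ λ M → ⌈εN⌉ ≡ + M × k ≤ M ℕ.* (suc d ℕ.* (2 ℕ.* suc r′))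
  ⌈εN⌉-bound = cross ⌈εN⌉ (≤-toℚᵘ εN≃ (ι-toℚᵘ ⌈εN⌉) (p≤ι⌈p⌉ (ε ℚ.* N)))
    where
    εN≃ : toℚᵘ (ε ℚ.* N) ℚᵘ.≃ mkℚᵘ (+ suc e) d ℚᵘ.* mkℚᵘ (+ k) _
    εN≃ = ℚᵘP.≃-trans (ℚP.toℚᵘ-homo-* ε N) (ℚᵘP.*-cong ℚᵘP.≃-refl (toℚᵘ-/ (+ k) _))
    sek≡ : (+ suc e ℤ.* + k) ℤ.* + 1 ≡ + (suc e ℕ.* k ℕ.* 1)
    sek≡ = trans (cong (ℤ._* + 1) (sym (ℤP.pos-* (suc e) k))) (sym (ℤP.pos-* (suc e ℕ.* k) 1))
    cross : ∀ C → mkℚᵘ (+ suc e) d ℚᵘ.* mkℚᵘ (+ k) _ ℚᵘ.≤ mkℚᵘ C 0 →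
      ∃ λ M → C ≡ + M × k ≤ M ℕ.* (suc d ℕ.* (2 ℕ.* suc r′))
    cross (+ M) (*≤* le) with subst₂ ℤ._≤_ sek≡ (sym (ℤP.pos-* M _)) le
    ... | +≤+ sek≤M*D = M , refl , ℕP.≤-trans (ℕP.m≤m+n k (e ℕ.* k))
                           (ℕP.≤-trans (ℕP.≤-reflexive (sym (ℕP.*-identityʳ (suc e ℕ.* k)))) sek≤M*D)
    cross -[1+ n ] (*≤* le) with subst (ℤ._≤ _) sek≡ le
    ... | ()

  NaturalCoordinate : ℕ → ℤ → Set
  NaturalCoordinate M x = ∃ λ X → x ≡ + X × M ≤ X × X ℕ.* (2 ℕ.* suc r′) ≤ k

  coordinate-bound : ∀ {M x} → ⌈εN⌉ ≡ + M → ⌈εN⌉ ℤ.≤ x → ι x ℚ.≤ N → NaturalCoordinate M x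
  coordinate-bound {M} {x} ⌈εN⌉≡M ⌈εN⌉≤x x≤N =
    cross x (subst (ℤ._≤ x) ⌈εN⌉≡M ⌈εN⌉≤x) (≤-toℚᵘ (ι-toℚᵘ x) (toℚᵘ-/ (+ k) _) x≤N)
    where
    cross : ∀ x → + M ℤ.≤ x → mkℚᵘ x 0 ℚᵘ.≤ mkℚᵘ (+ k) _ → NaturalCoordinate M x
    cross (+ X) (+≤+ M≤X) (*≤* le) with subst₂ ℤ._≤_ (sym (ℤP.pos-* X _)) (sym (ℤP.pos-* k 1)) le
    ... | +≤+ X*2r≤k*1 = X , refl , M≤X , ℕP.≤-trans X*2r≤k*1 (ℕP.≤-reflexive (ℕP.*-identityʳ k))

  admissible-of : ∀ {M a b c} → NaturalCoordinate M a → NaturalCoordinate M b → NaturalCoordinate M c →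
    Indivisible (a , b , c) → Admissible k (suc r′) M (a , b , c)
  admissible-of (A , refl , M≤A , A*2r≤k) (B , refl , _ , B*2r≤k) (C , refl , _ , C*2r≤k) gcd≡1 =
    admissible A B C refl M≤A A*2r≤k B*2r≤k C*2r≤k (ℤP.+-injective gcd≡1)

  validS⇒admissible : ∀ {S M} → ValidS ε k (suc r′) S → ⌈εN⌉ ≡ + M →
    ∀ {v} → v ∈ S → Admissible k (suc r′) M v
  validS⇒admissible (_ , indivisible , coordinates , _) ⌈εN⌉≡M {a , b , c} v∈S
    with coordinates v∈S
  ... | (a₁ , a₂) , (b₁ , b₂) , (c₁ , c₂) =
    admissible-of (coordinate-bound ⌈εN⌉≡M a₁ a₂) (coordinate-bound ⌈εN⌉≡M b₁ b₂)
                  (coordinate-bound ⌈εN⌉≡M c₁ c₂) (indivisible v∈S)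

  validS⇒many-lines : ∀ {S} → ValidS ε k (suc r′) S → ∃ λ M →
    k ≤ M ℕ.* (suc d ℕ.* (2 ℕ.* suc r′)) × CardLAtLeast S k (suc r′) (LineIndex k (suc r′) M S)
  validS⇒many-lines {S} valid@(unique , _) =
    M , k≤M*D*2r , many-lines k (suc r′) M S unique (validS⇒admissible valid ⌈εN⌉≡M)
    where
    M : ℕ
    M = proj₁ ⌈εN⌉-bound
    ⌈εN⌉≡M : ⌈εN⌉ ≡ + M
    ⌈εN⌉≡M = proj₁ (proj₂ ⌈εN⌉-bound)
    k≤M*D*2r : k ≤ M ℕ.* (suc d ℕ.* (2 ℕ.* suc r′))
    k≤M*D*2r = proj₂ (proj₂ ⌈εN⌉-bound)

lemma2p2 : (ε : ℚ) → 0ℚ ℚ.< ε → ε ℚ.< 1ℚ →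
    ∃ λ (c : ℚ) → (0ℚ ℚ.< c) × (∃ λ (K : ℕ) →
      (k r : ℕ) → .{{_ : ℕ.NonZero r}} → K ℕ.≤ k → r ℕ.< k →
      (S : List ℤ³) → ValidS ε k r S →
      ∃ λ (m : ℕ) → (c ℚ.* ((+ (k ^ 3 ℕ.* length S)) / r) ℚ.≤ (+ m / 1)) × CardLAtLeast S k r m)
lemma2p2 (mkℚ (+ suc e) d coprime) _ _ = c , c>0 , 0 , many
  where
  c : ℚ
  c = + 1 / (32 ℕ.* suc d)
  c>0 : 0ℚ ℚ.< c
  c>0 = ℚP.positive⁻¹ c {{ℚP.normalize-pos 1 (32 ℕ.* suc d)}}
  many : (k r : ℕ) → .{{_ : ℕ.NonZero r}} → 0 ℕ.≤ k → r ℕ.< k →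
    (S : List ℤ³) → ValidS (mkℚ (+ suc e) d coprime) k r S →
    ∃ λ (m : ℕ) → (c ℚ.* ((+ (k ^ 3 ℕ.* length S)) / r) ℚ.≤ (+ m / 1)) × CardLAtLeast S k r m
  many k (suc r′) _ r<k S valid =
    LineIndex k (suc r′) M S ,
    [1/a]*[X/b]≤Y (32 ℕ.* suc d) (suc r′) {k ^ 3 ℕ.* length S} {LineIndex k (suc r′) M S}
      (cube≤ (length S) M (half k) (suc d) (suc r′) k≤M*D*2r (k≤4*half (ℕP.≤-trans (s≤s (s≤s z≤n)) r<k))) ,
    lines
    where
    open Σ (validS⇒many-lines e d k r′ valid) renaming (proj₁ to M; proj₂ to bound-and-lines)
    k≤M*D*2r : k ≤ M ℕ.* (suc d ℕ.* (2 ℕ.* suc r′))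
    k≤M*D*2r = proj₁ bound-and-lines
    lines : CardLAtLeast S k (suc r′) (LineIndex k (suc r′) M S)
    lines = proj₂ bound-and-lines
lemma2p2 (mkℚ (+ zero) _ _) (ℚ.*<* (ℤ.+<+ ())) _
lemma2p2 (mkℚ -[1+ _ ] _ _) (ℚ.*<* ()) _
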